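{- Let $\rho$ be a $V$-pointed higher-order GSOS law of $\Sigma$ over $B$ and let $(A,a)$ be a $\Sigma$-algebra. Then $B((\!|a|\!),\mathrm{id}_A)\circ a^\clubsuit = B(\mathrm{id}_{\mu\Sigma},(\!|a|\!))\circ\iota^\clubsuit$ as morphisms $\mu\Sigma\to B(\mu\Sigma,A)$.
   Context: $\mathbb{C}$ is a category with finite limits and finite colimits, $V$ an object of $\mathbb{C}$, $\Sigma=V+\Sigma'\colon\mathbb{C}\to\mathbb{C}$ with $\Sigma'$ admitting free algebras (so the free monad $\Sigma^\star$ exists), and $B\colon\mathbb{C}^{\mathsf{op}}\times\mathbb{C}\to\mathbb{C}$ a functor. $(\mu\Sigma,\iota)$ is the initial $\Sigma$-algebra; $(\!|a|\!)\colon\mu\Sigma\to A$ the unique algebra morphism; $\hat a\colon\Sigma^\star A\to A$ the unique algebra morphism extending $\mathrm{id}_A$; $\nabla$ the codiagonal. $V/\mathbb{C}$ is the coslice category, $j\colon V/\mathbb{C}\to\mathbb{C}$ the forgetful functor; each $\Sigma$-algebra $(A,a)$ is $V$-pointed via $a\circ\mathrm{inl}\colon V\to A$. A $V$-pointed higher-order GSOS law is a family $\rho_{X,Y}\colon\Sigma(jX\times B(jX,Y))\to B(jX,\Sigma^\star(jX+Y))$ dinatural in $X\in V/\mathbb{C}$ and natural in $Y\in\mathbb{C}$. For a $\Sigma$-algebra $(A,a)$, $a^\clubsuit\colon\mu\Sigma\to B(A,A)$ is the unique morphism with $a^\clubsuit\circ\iota=B(\mathrm{id},\hat a)\circ B(\mathrm{id},\Sigma^\star\nabla)\circ\rho_{A,A}\circ\Sigma\langle(\!|a|\!),a^\clubsuit\rangle$,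 and $\iota^\clubsuit\colon\mu\Sigma\to B(\mu\Sigma,\mu\Sigma)$ is this morphism for $(A,a)=(\mu\Sigma,\iota)$. -}

module Defs where

open import Level using (Level; _⊔_) renaming (suc to lsuc)
open import Relation.Binary.PropositionalEquality using (_≡_)

record Category (o ℓ : Level) : Set (lsuc (o ⊔ ℓ)) where
  infixr 9 _∘_
  field
    Obj  : Set o
    Hom  : Obj → Obj → Set ℓ
    id   : ∀ {A} → Hom A A
    _∘_  : ∀ {A B C} → Hom B C → Hom A B → Hom A C
    identityˡ : ∀ {A B} {f : Hom A B} → id ∘ f ≡ f
    identityʳ : ∀ {A B} {f : Hom A B} → f ∘ id ≡ f
    assoc : ∀ {A B C D} {f : Hom A B} {g : Hom B C} {h : Hom C D} →
            (h ∘ g) ∘ f ≡ h ∘ (g ∘ f)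

module _ {o ℓ : Level} (C : Category o ℓ) where
  open Category C

  record Terminal : Set (o ⊔ ℓ) where
    field
      ⊤ : Obj
      ! : ∀ {A} → Hom A ⊤
      !-unique : ∀ {A} (h : Hom A ⊤) → h ≡ !

  record Initial : Set (o ⊔ ℓ) where
    field
      ⊥ : Obj
      ¡ : ∀ {A} → Hom ⊥ A
      ¡-unique : ∀ {A} (h : Hom ⊥ A) → h ≡ ¡

  record BinaryProducts : Set (o ⊔ ℓ) where
    infixr 7 _⊗_
    field
      _⊗_ : Obj → Obj → Obj
      π₁ : ∀ {A B} → Hom (A ⊗ B) A
      π₂ : ∀ {A B} → Hom (A ⊗ B) B
      ⟨_,_⟩ : ∀ {X A B} → Hom X A → Hom X B → Hom X (A ⊗ B)
      project₁ : ∀ {X A B} {f : Hom X A} {g : Hom X B} → π₁ ∘ ⟨ f , g ⟩ ≡ f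
      project₂ : ∀ {X A B} {f : Hom X A} {g : Hom X B} → π₂ ∘ ⟨ f , g ⟩ ≡ g
      ⟨⟩-unique : ∀ {X A B} {f : Hom X A} {g : Hom X B} (h : Hom X (A ⊗ B)) →
                  π₁ ∘ h ≡ f → π₂ ∘ h ≡ g → h ≡ ⟨ f , g ⟩

  record BinaryCoproducts : Set (o ⊔ ℓ) where
    infixr 6 _⊕_
    field
      _⊕_ : Obj → Obj → Obj
      inl : ∀ {A B} → Hom A (A ⊕ B)
      inr : ∀ {A B} → Hom B (A ⊕ B)
      [_,_] : ∀ {X A B} → Hom A X → Hom B X → Hom (A ⊕ B) X
      inject₁ : ∀ {X A B} {f : Hom A X} {g : Hom B X} → [ f , g ] ∘ inl ≡ f
      inject₂ : ∀ {X A B} {f : Hom A X} {g : Hom B X} → [ f , g ] ∘ inr ≡ g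
      []-unique : ∀ {X A B} {f : Hom A X} {g : Hom B X} (h : Hom (A ⊕ B) X) →
                  h ∘ inl ≡ f → h ∘ inr ≡ g → h ≡ [ f , g ]

  record Equalizers : Set (o ⊔ ℓ) where
    field
      Eq : ∀ {A B} → Hom A B → Hom A B → Obj
      eq : ∀ {A B} {f g : Hom A B} → Hom (Eq f g) A
      equality : ∀ {A B} {f g : Hom A B} → f ∘ eq {f = f} {g} ≡ g ∘ eq
      equalize : ∀ {A B X} {f g : Hom A B} (h : Hom X A) → f ∘ h ≡ g ∘ h → Hom X (Eq f g)
      equalize-fac : ∀ {A B X} {f g : Hom A B} {h : Hom X A} (p : f ∘ h ≡ g ∘ h) →
                     eq ∘ equalize h p ≡ h
      equalize-unique : ∀ {A B X} {f g : Hom A B} {h : Hom X A} (p : f ∘ h ≡ g ∘ h)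
                        (u : Hom X (Eq f g)) → eq ∘ u ≡ h → u ≡ equalize h p

  record Coequalizers : Set (o ⊔ ℓ) where
    field
      Coeq : ∀ {A B} → Hom A B → Hom A B → Obj
      coeq : ∀ {A B} {f g : Hom A B} → Hom B (Coeq f g)
      equality : ∀ {A B} {f g : Hom A B} → coeq {f = f} {g} ∘ f ≡ coeq ∘ g
      coequalize : ∀ {A B X} {f g : Hom A B} (h : Hom B X) → h ∘ f ≡ h ∘ g → Hom (Coeq f g) X
      coequalize-fac : ∀ {A B X} {f g : Hom A B} {h : Hom B X} (p : h ∘ f ≡ h ∘ g) →
                       coequalize h p ∘ coeq ≡ h
      coequalize-unique : ∀ {A B X} {f g : Hom A B} {h : Hom B X} (p : h ∘ f ≡ h ∘ g)
                          (u : Hom (Coeq f g) X) → u ∘ coeq ≡ h → u ≡ coequalize h p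

  record FinitelyComplete : Set (o ⊔ ℓ) where
    field
      terminal : Terminal
      products : BinaryProducts
      equalizers : Equalizers

  record FinitelyCocomplete : Set (o ⊔ ℓ) where
    field
      initial : Initial
      coproducts : BinaryCoproducts
      coequalizers : Coequalizers

  record Endofunctor : Set (o ⊔ ℓ) where
    field
      F₀ : Obj → Obj
      F₁ : ∀ {A B} → Hom A B → Hom (F₀ A) (F₀ B)
      identity : ∀ {A} → F₁ (id {A}) ≡ id
      homomorphism : ∀ {A B C} {f : Hom A B} {g : Hom B C} → F₁ (g ∘ f) ≡ F₁ g ∘ F₁ f

  -- functors C^op × C → C
  record Bifunctor : Set (o ⊔ ℓ) where
    field
      B₀ : Obj → Obj → Obj
      B₁ : ∀ {A A' X X'} → Hom A' A → Hom X X' → Hom (B₀ A X) (B₀ A' X')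
      identity : ∀ {A X} → B₁ (id {A}) (id {X}) ≡ id
      homomorphism : ∀ {A A' A'' X X' X''} {f : Hom A' A} {f' : Hom A'' A'}
                     {g : Hom X X'} {g' : Hom X' X''} →
                     B₁ (f ∘ f') (g' ∘ g) ≡ B₁ f' g' ∘ B₁ f g

  record FreeAlgebra (F : Endofunctor) (X : Obj) : Set (o ⊔ ℓ) where
    open Endofunctor F
    field
      T : Obj
      alg : Hom (F₀ T) T
      η : Hom X T
      ext : ∀ {A} → Hom (F₀ A) A → Hom X A → Hom T A
      ext-η : ∀ {A} {a : Hom (F₀ A) A} {f : Hom X A} → ext a f ∘ η ≡ f
      ext-hom : ∀ {A} {a : Hom (F₀ A) A} {f : Hom X A} → ext a f ∘ alg ≡ a ∘ F₁ (ext a f)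
      ext-unique : ∀ {A} {a : Hom (F₀ A) A} {f : Hom X A} (h : Hom T A) →
                   h ∘ η ≡ f → h ∘ alg ≡ a ∘ F₁ h → h ≡ ext a f

  HasFreeAlgebras : Endofunctor → Set (o ⊔ ℓ)
  HasFreeAlgebras F = (X : Obj) → FreeAlgebra F X

module Setting {o ℓ : Level} (C : Category o ℓ)
  (lim : FinitelyComplete C) (colim : FinitelyCocomplete C)
  (V : Category.Obj C) (Σ' : Endofunctor C) (free : HasFreeAlgebras C Σ')
  (B : Bifunctor C) where

  open Category C
  open BinaryProducts (FinitelyComplete.products lim)
  open BinaryCoproducts (FinitelyCocomplete.coproducts colim)
  open Endofunctor Σ' renaming (F₀ to Σ'₀; F₁ to Σ'₁)
  open Bifunctor B

  _⊗₁_ : ∀ {A A' X X'} → Hom A A' → Hom X X' → Hom (A ⊗ X) (A' ⊗ X')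
  f ⊗₁ g = ⟨ f ∘ π₁ , g ∘ π₂ ⟩

  _⊕₁_ : ∀ {A A' X X'} → Hom A A' → Hom X X' → Hom (A ⊕ X) (A' ⊕ X')
  f ⊕₁ g = [ inl ∘ f , inr ∘ g ]

  ∇ : ∀ {A} → Hom (A ⊕ A) A
  ∇ = [ id , id ]

  Σ₀ : Obj → Obj
  Σ₀ X = V ⊕ Σ'₀ X

  Σ₁ : ∀ {X Y} → Hom X Y → Hom (Σ₀ X) (Σ₀ Y)
  Σ₁ f = id ⊕₁ Σ'₁ f

  -- free monad Σ⋆ : Σ⋆X is the free Σ'-algebra on V + X
  Σ⋆₀ : Obj → Obj
  Σ⋆₀ X = FreeAlgebra.T (free (V ⊕ X))

  Σ⋆alg : ∀ {X} → Hom (Σ₀ (Σ⋆₀ X)) (Σ⋆₀ X)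
  Σ⋆alg {X} = [ η ∘ inl , alg ]
    where open FreeAlgebra (free (V ⊕ X))

  Σ⋆η : ∀ {X} → Hom X (Σ⋆₀ X)
  Σ⋆η {X} = FreeAlgebra.η (free (V ⊕ X)) ∘ inr

  Σ⋆₁ : ∀ {X Y} → Hom X Y → Hom (Σ⋆₀ X) (Σ⋆₀ Y)
  Σ⋆₁ {X} {Y} h =
    FreeAlgebra.ext (free (V ⊕ X)) (FreeAlgebra.alg (free (V ⊕ Y)))
                    (FreeAlgebra.η (free (V ⊕ Y)) ∘ (id ⊕₁ h))

  -- â : Σ⋆A → A, the unique Σ-algebra morphism extending id_A
  hat : ∀ {A} → Hom (Σ₀ A) A → Hom (Σ⋆₀ A) A
  hat {A} a = FreeAlgebra.ext (free (V ⊕ A)) (a ∘ inr) [ a ∘ inl , id ]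

  -- the coslice category V/C (objects and morphisms; j is the first projection)
  record PointedObj : Set (o ⊔ ℓ) where
    constructor _,pt_
    field
      obj : Obj
      pt  : Hom V obj
  open PointedObj public

  record PointedHom (X Y : PointedObj) : Set ℓ where
    constructor _,ptd_
    field
      mor : Hom (obj X) (obj Y)
      preserves : mor ∘ pt X ≡ pt Y
  open PointedHom public

  pointed : ∀ {A} → Hom (Σ₀ A) A → PointedObj
  pointed {A} a = A ,pt (a ∘ inl)

  record PointedHOGSOS : Set (o ⊔ ℓ) where
    field
      ρ : (X : PointedObj) (Y : Obj) →
          Hom (Σ₀ (obj X ⊗ B₀ (obj X) Y)) (B₀ (obj X) (Σ⋆₀ (obj X ⊕ Y)))
      dinatural : ∀ {X X' : PointedObj} (f : PointedHom X X') (Y : Obj) →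
        B₁ id (Σ⋆₁ (mor f ⊕₁ id)) ∘ ρ X Y ∘ Σ₁ (id ⊗₁ B₁ (mor f) id)
          ≡ B₁ (mor f) id ∘ ρ X' Y ∘ Σ₁ (mor f ⊗₁ id)
      natural : ∀ (X : PointedObj) {Y Y' : Obj} (g : Hom Y Y') →
        B₁ id (Σ⋆₁ (id ⊕₁ g)) ∘ ρ X Y ≡ ρ X Y' ∘ Σ₁ (id ⊗₁ B₁ id g)

  record InitialΣAlgebra : Set (o ⊔ ℓ) where
    field
      μΣ : Obj
      ι : Hom (Σ₀ μΣ) μΣ
      fold : ∀ {A} → Hom (Σ₀ A) A → Hom μΣ A
      fold-hom : ∀ {A} {a : Hom (Σ₀ A) A} → fold a ∘ ι ≡ a ∘ Σ₁ (fold a)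
      fold-unique : ∀ {A} {a : Hom (Σ₀ A) A} (h : Hom μΣ A) →
                    h ∘ ι ≡ a ∘ Σ₁ h → h ≡ fold a

  -- c satisfies the defining equation of a♣ :
  --   c ∘ ι = B(id, â) ∘ B(id, Σ⋆∇) ∘ ρ_{A,A} ∘ Σ⟨(| a |), c⟩
  IsClub : (init : InitialΣAlgebra) (law : PointedHOGSOS) {A : Obj}
           (a : Hom (Σ₀ A) A) → Hom (InitialΣAlgebra.μΣ init) (B₀ A A) → Set ℓ
  IsClub init law {A} a c =
    c ∘ ι ≡ B₁ id (hat a) ∘ B₁ id (Σ⋆₁ ∇) ∘ ρ (pointed a) A ∘ Σ₁ ⟨ fold a , c ⟩
    where open InitialΣAlgebra init
          open PointedHOGSOS law

-- Both sides are solutions g : μΣ → B(μΣ, A) of one primitive-recursion equation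
--   g ∘ ι = B(id, â ∘ Σ⋆[(| a |), id]) ∘ ρ_{μΣ,A} ∘ Σ⟨id, g⟩,
-- and such solutions are unique because ⟨id, g⟩ is then a fold. For the left side this
-- follows from dinaturality of ρ along the pointed map (| a |), for the right side from
-- naturality of ρ in its second argument together with (| a |) ∘ ι̂ = â ∘ Σ⋆(| a |).
module Submission where

open import Defs
open import Relation.Binary.PropositionalEquality
  using (_≡_; refl; sym; trans; cong; cong₂; module ≡-Reasoning)

module ClubNaturality {o ℓ} (C : Category o ℓ) (lim : FinitelyComplete C)
    (colim : FinitelyCocomplete C) (V : Category.Obj C) (Σ' : Endofunctor C)
    (free : HasFreeAlgebras C Σ') (B : Bifunctor C) where
  open Category C
  open Setting C lim colim V Σ' free B
  open BinaryProducts (FinitelyComplete.products lim)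
  open BinaryCoproducts (FinitelyCocomplete.coproducts colim)
  open Endofunctor Σ' renaming (F₀ to Σ'₀; F₁ to Σ'₁; identity to Σ'-identity;
                                homomorphism to Σ'-homomorphism)
  open Bifunctor B renaming (homomorphism to B-homomorphism)
  open ≡-Reasoning

  pullˡ : ∀ {W X Y Z} {f : Hom X Y} {g : Hom Y Z} {k : Hom X Z} {x : Hom W X} →
          g ∘ f ≡ k → g ∘ f ∘ x ≡ k ∘ x
  pullˡ {x = x} p = trans (sym assoc) (cong (_∘ x) p)

  precompose₃ : ∀ {U W X X' Y Y' Z} {f : Hom Y Z} {f' : Hom Y' Z} {g : Hom X Y}
                {g' : Hom X' Y'} {k : Hom W X} {k' : Hom W X'} {x : Hom U W} →
                f ∘ g ∘ k ≡ f' ∘ g' ∘ k' → f ∘ g ∘ k ∘ x ≡ f' ∘ g' ∘ k' ∘ x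
  precompose₃ {f = f} {f'} {g} {g'} {k} {k'} {x} p = begin
    f ∘ g ∘ k ∘ x      ≡⟨ cong (f ∘_) (sym assoc) ⟩
    f ∘ (g ∘ k) ∘ x    ≡⟨ sym assoc ⟩
    (f ∘ g ∘ k) ∘ x    ≡⟨ cong (_∘ x) p ⟩
    (f' ∘ g' ∘ k') ∘ x ≡⟨ assoc ⟩
    f' ∘ (g' ∘ k') ∘ x ≡⟨ cong (f' ∘_) assoc ⟩
    f' ∘ g' ∘ k' ∘ x   ∎

  ⟨⟩-ext : ∀ {X P Q} {f g : Hom X (P ⊗ Q)} → π₁ ∘ f ≡ π₁ ∘ g → π₂ ∘ f ≡ π₂ ∘ g → f ≡ g
  ⟨⟩-ext {f = f} {g} p q = trans (⟨⟩-unique f p q) (sym (⟨⟩-unique g refl refl))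

  ∘[] : ∀ {P Q X Y} {k : Hom X Y} {f : Hom P X} {g : Hom Q X} →
        k ∘ [ f , g ] ≡ [ k ∘ f , k ∘ g ]
  ∘[] {k = k} = []-unique _ (trans assoc (cong (k ∘_) inject₁))
                            (trans assoc (cong (k ∘_) inject₂))

  []∘⊕₁ : ∀ {P Q P' Q' X} {f : Hom P' X} {g : Hom Q' X} {u : Hom P P'} {v : Hom Q Q'} →
          [ f , g ] ∘ (u ⊕₁ v) ≡ [ f ∘ u , g ∘ v ]
  []∘⊕₁ = trans ∘[] (cong₂ [_,_] (pullˡ inject₁) (pullˡ inject₂))

  ⊕₁-∘ : ∀ {P Q P' Q' P'' Q''} {f : Hom P' P''} {g : Hom Q' Q''}
         {f' : Hom P P'} {g' : Hom Q Q'} → (f ⊕₁ g) ∘ (f' ⊕₁ g') ≡ (f ∘ f') ⊕₁ (g ∘ g')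
  ⊕₁-∘ = trans []∘⊕₁ (cong₂ [_,_] assoc assoc)

  ∇∘⊕₁ : ∀ {P Q X} {f : Hom P X} {g : Hom Q X} → ∇ ∘ (f ⊕₁ g) ≡ [ f , g ]
  ∇∘⊕₁ = trans []∘⊕₁ (cong₂ [_,_] identityˡ identityˡ)

  ⊗₁∘⟨⟩ : ∀ {X P Q P' Q'} {f : Hom P P'} {g : Hom Q Q'} {u : Hom X P} {v : Hom X Q} →
          (f ⊗₁ g) ∘ ⟨ u , v ⟩ ≡ ⟨ f ∘ u , g ∘ v ⟩
  ⊗₁∘⟨⟩ {f = f} {g} = ⟨⟩-unique _
    (trans (pullˡ project₁) (trans assoc (cong (f ∘_) project₁)))
    (trans (pullˡ project₂) (trans assoc (cong (g ∘_) project₂)))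

  Σ₁-identity : ∀ {X} → Σ₁ (id {X}) ≡ id
  Σ₁-identity = sym ([]-unique id (trans identityˡ (sym identityʳ))
    (trans identityˡ (sym (trans (cong (inr ∘_) Σ'-identity) identityʳ))))

  Σ₁-homomorphism : ∀ {X Y Z} {f : Hom X Y} {g : Hom Y Z} → Σ₁ g ∘ Σ₁ f ≡ Σ₁ (g ∘ f)
  Σ₁-homomorphism = trans ⊕₁-∘ (cong₂ _⊕₁_ identityˡ (sym Σ'-homomorphism))

  Σ₁-⊗₁∘⟨⟩ : ∀ {X P Q P' Q'} {f : Hom P P'} {g : Hom Q Q'} {u : Hom X P} {v : Hom X Q} →
             Σ₁ (f ⊗₁ g) ∘ Σ₁ ⟨ u , v ⟩ ≡ Σ₁ ⟨ f ∘ u , g ∘ v ⟩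
  Σ₁-⊗₁∘⟨⟩ = trans Σ₁-homomorphism (cong Σ₁ ⊗₁∘⟨⟩)

  B₁-id-∘ : ∀ {P X Y Z} {x : Hom Y Z} {y : Hom X Y} → B₁ (id {P}) x ∘ B₁ id y ≡ B₁ id (x ∘ y)
  B₁-id-∘ {x = x} {y} = trans (sym B-homomorphism) (cong (λ z → B₁ z (x ∘ y)) identityˡ)

  B₁-commute : ∀ {P Q X Y} {f : Hom P Q} {x : Hom X Y} →
               B₁ f id ∘ B₁ id x ≡ B₁ id x ∘ B₁ f id
  B₁-commute = trans (sym B-homomorphism)
    (trans (cong₂ B₁ (trans identityˡ (sym identityʳ)) (trans identityˡ (sym identityʳ)))
           B-homomorphism)

  module Free (X : Obj) = FreeAlgebra (free (V ⊕ X))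

  IsΣ'Hom : ∀ {P Q} → Hom (Σ'₀ P) P → Hom (Σ'₀ Q) Q → Hom P Q → Set ℓ
  IsΣ'Hom α β k = k ∘ α ≡ β ∘ Σ'₁ k

  IsΣ'Hom-∘ : ∀ {P Q R} {α : Hom (Σ'₀ P) P} {β : Hom (Σ'₀ Q) Q} {γ : Hom (Σ'₀ R) R}
              {k : Hom P Q} {m : Hom Q R} →
              IsΣ'Hom α β k → IsΣ'Hom β γ m → IsΣ'Hom α γ (m ∘ k)
  IsΣ'Hom-∘ {α = α} {β} {γ} {k} {m} p q = begin
    (m ∘ k) ∘ α         ≡⟨ assoc ⟩
    m ∘ k ∘ α           ≡⟨ cong (m ∘_) p ⟩
    m ∘ β ∘ Σ'₁ k       ≡⟨ pullˡ q ⟩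
    (γ ∘ Σ'₁ m) ∘ Σ'₁ k ≡⟨ assoc ⟩
    γ ∘ Σ'₁ m ∘ Σ'₁ k   ≡⟨ cong (γ ∘_) (sym Σ'-homomorphism) ⟩
    γ ∘ Σ'₁ (m ∘ k)     ∎

  free-hom-unique : ∀ {X Y} {β : Hom (Σ'₀ Y) Y} {k₁ k₂ : Hom (Σ⋆₀ X) Y} →
                    IsΣ'Hom (Free.alg X) β k₁ → IsΣ'Hom (Free.alg X) β k₂ →
                    k₁ ∘ Free.η X ≡ k₂ ∘ Free.η X → k₁ ≡ k₂
  free-hom-unique {X} {k₁ = k₁} {k₂} p₁ p₂ e =
    trans (Free.ext-unique X k₁ e p₁) (sym (Free.ext-unique X k₂ refl p₂))

  Σ⋆₁-homomorphism : ∀ {X Y Z} {f : Hom X Y} {g : Hom Y Z} → Σ⋆₁ g ∘ Σ⋆₁ f ≡ Σ⋆₁ (g ∘ f)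
  Σ⋆₁-homomorphism {X} {Y} {Z} {f} {g} =
    free-hom-unique (IsΣ'Hom-∘ (Free.ext-hom X) (Free.ext-hom Y)) (Free.ext-hom X) (begin
      (Σ⋆₁ g ∘ Σ⋆₁ f) ∘ Free.η X          ≡⟨ assoc ⟩
      Σ⋆₁ g ∘ Σ⋆₁ f ∘ Free.η X            ≡⟨ cong (Σ⋆₁ g ∘_) (Free.ext-η X) ⟩
      Σ⋆₁ g ∘ Free.η Y ∘ (id ⊕₁ f)        ≡⟨ pullˡ (Free.ext-η Y) ⟩
      (Free.η Z ∘ (id ⊕₁ g)) ∘ (id ⊕₁ f)  ≡⟨ assoc ⟩
      Free.η Z ∘ (id ⊕₁ g) ∘ (id ⊕₁ f)    ≡⟨ cong (Free.η Z ∘_) ⊕₁-∘ ⟩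
      Free.η Z ∘ ((id ∘ id) ⊕₁ (g ∘ f))   ≡⟨ cong (λ z → Free.η Z ∘ (z ⊕₁ (g ∘ f))) identityˡ ⟩
      Free.η Z ∘ (id ⊕₁ (g ∘ f))          ≡⟨ sym (Free.ext-η X) ⟩
      Σ⋆₁ (g ∘ f) ∘ Free.η X              ∎)

  IsΣHom : ∀ {P Q} → Hom (Σ₀ P) P → Hom (Σ₀ Q) Q → Hom P Q → Set ℓ
  IsΣHom α β k = k ∘ α ≡ β ∘ Σ₁ k

  IsΣHom-inl : ∀ {P Q} {α : Hom (Σ₀ P) P} {β : Hom (Σ₀ Q) Q} {k : Hom P Q} →
               IsΣHom α β k → k ∘ α ∘ inl ≡ β ∘ inl
  IsΣHom-inl {β = β} p = trans (pullˡ p) (trans assoc (cong (β ∘_) (trans inject₁ identityʳ)))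

  IsΣHom-inr : ∀ {P Q} {α : Hom (Σ₀ P) P} {β : Hom (Σ₀ Q) Q} {k : Hom P Q} →
               IsΣHom α β k → IsΣ'Hom (α ∘ inr) (β ∘ inr) k
  IsΣHom-inr {β = β} p = trans (pullˡ p) (trans assoc (trans (cong (β ∘_) inject₂) (sym assoc)))

  hat-natural : ∀ {P Q} {α : Hom (Σ₀ P) P} {β : Hom (Σ₀ Q) Q} {k : Hom P Q} →
                IsΣHom α β k → k ∘ hat α ≡ hat β ∘ Σ⋆₁ k
  hat-natural {P} {Q} {α} {β} {k} p =
    free-hom-unique (IsΣ'Hom-∘ (Free.ext-hom P) (IsΣHom-inr p))
                    (IsΣ'Hom-∘ (Free.ext-hom P) (Free.ext-hom Q)) (begin
      (k ∘ hat α) ∘ Free.η P                  ≡⟨ assoc ⟩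
      k ∘ hat α ∘ Free.η P                    ≡⟨ cong (k ∘_) (Free.ext-η P) ⟩
      k ∘ [ α ∘ inl , id ]                    ≡⟨ trans ∘[] (cong₂ [_,_] (IsΣHom-inl p) identityʳ) ⟩
      [ β ∘ inl , k ]                         ≡⟨ sym (trans []∘⊕₁ (cong₂ [_,_] identityʳ identityˡ)) ⟩
      [ β ∘ inl , id ] ∘ (id ⊕₁ k)            ≡⟨ sym (pullˡ (Free.ext-η Q)) ⟩
      hat β ∘ Free.η Q ∘ (id ⊕₁ k)            ≡⟨ cong (hat β ∘_) (sym (Free.ext-η P)) ⟩
      hat β ∘ Σ⋆₁ k ∘ Free.η P                ≡⟨ sym assoc ⟩
      (hat β ∘ Σ⋆₁ k) ∘ Free.η P              ∎)

  module _ (init : InitialΣAlgebra) where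
    open InitialΣAlgebra init

    fold-ι≡id : fold ι ≡ id
    fold-ι≡id = sym (fold-unique id
      (trans identityˡ (sym (trans (cong (ι ∘_) Σ₁-identity) identityʳ))))

    IsPrimRec : ∀ {X} → Hom (Σ₀ (μΣ ⊗ X)) X → Hom μΣ X → Set ℓ
    IsPrimRec E g = g ∘ ι ≡ E ∘ Σ₁ ⟨ id , g ⟩

    ⟨id,primRec⟩≡fold : ∀ {X} {E : Hom (Σ₀ (μΣ ⊗ X)) X} {g : Hom μΣ X} →
                        IsPrimRec E g → ⟨ id , g ⟩ ≡ fold ⟨ ι ∘ Σ₁ π₁ , E ⟩
    ⟨id,primRec⟩≡fold {E = E} {g} p = fold-unique _ (⟨⟩-ext
      (begin
        π₁ ∘ ⟨ id , g ⟩ ∘ ι                          ≡⟨ pullˡ project₁ ⟩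
        id ∘ ι                                       ≡⟨ identityˡ ⟩
        ι                                            ≡⟨ sym identityʳ ⟩
        ι ∘ id                                       ≡⟨ cong (ι ∘_) (sym (trans Σ₁-homomorphism
                                                          (trans (cong Σ₁ project₁) Σ₁-identity))) ⟩
        ι ∘ Σ₁ π₁ ∘ Σ₁ ⟨ id , g ⟩                    ≡⟨ sym assoc ⟩
        (ι ∘ Σ₁ π₁) ∘ Σ₁ ⟨ id , g ⟩                  ≡⟨ sym (pullˡ project₁) ⟩
        π₁ ∘ ⟨ ι ∘ Σ₁ π₁ , E ⟩ ∘ Σ₁ ⟨ id , g ⟩       ∎)
      (begin
        π₂ ∘ ⟨ id , g ⟩ ∘ ι                          ≡⟨ pullˡ project₂ ⟩
        g ∘ ι                                        ≡⟨ p ⟩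
        E ∘ Σ₁ ⟨ id , g ⟩                            ≡⟨ sym (pullˡ project₂) ⟩
        π₂ ∘ ⟨ ι ∘ Σ₁ π₁ , E ⟩ ∘ Σ₁ ⟨ id , g ⟩       ∎))

    primRec-unique : ∀ {X} {E : Hom (Σ₀ (μΣ ⊗ X)) X} {g₁ g₂ : Hom μΣ X} →
                     IsPrimRec E g₁ → IsPrimRec E g₂ → g₁ ≡ g₂
    primRec-unique {E = E} {g₁} {g₂} p₁ p₂ = begin
      g₁                          ≡⟨ sym project₂ ⟩
      π₂ ∘ ⟨ id , g₁ ⟩            ≡⟨ cong (π₂ ∘_) (⟨id,primRec⟩≡fold p₁) ⟩
      π₂ ∘ fold ⟨ ι ∘ Σ₁ π₁ , E ⟩ ≡⟨ cong (π₂ ∘_) (sym (⟨id,primRec⟩≡fold p₂)) ⟩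
      π₂ ∘ ⟨ id , g₂ ⟩            ≡⟨ project₂ ⟩
      g₂                          ∎

    module _ (law : PointedHOGSOS) {A : Obj} (a : Hom (Σ₀ A) A) where
      open PointedHOGSOS law

      h : Hom μΣ A
      h = fold a

      fold-pointed : PointedHom (pointed ι) (pointed a)
      fold-pointed = h ,ptd IsΣHom-inl fold-hom

      K : Hom (Σ⋆₀ (μΣ ⊕ A)) A
      K = hat a ∘ Σ⋆₁ [ h , id ]

      E : Hom (Σ₀ (μΣ ⊗ B₀ μΣ A)) (B₀ μΣ A)
      E = B₁ id K ∘ ρ (pointed ι) A

      hat∘Σ⋆∇∘Σ⋆⊕₁ : (hat a ∘ Σ⋆₁ ∇) ∘ Σ⋆₁ (h ⊕₁ id) ≡ K
      hat∘Σ⋆∇∘Σ⋆⊕₁ = trans assoc (cong (hat a ∘_) (trans Σ⋆₁-homomorphism (cong Σ⋆₁ ∇∘⊕₁)))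

      fold∘hat∘Σ⋆∇ : h ∘ hat ι ∘ Σ⋆₁ ∇ ≡ K ∘ Σ⋆₁ (id ⊕₁ h)
      fold∘hat∘Σ⋆∇ = begin
        h ∘ hat ι ∘ Σ⋆₁ ∇                ≡⟨ pullˡ (hat-natural fold-hom) ⟩
        (hat a ∘ Σ⋆₁ h) ∘ Σ⋆₁ ∇          ≡⟨ trans assoc (cong (hat a ∘_) Σ⋆₁-homomorphism) ⟩
        hat a ∘ Σ⋆₁ (h ∘ ∇)              ≡⟨ cong (λ z → hat a ∘ Σ⋆₁ z) (sym [h,id]∘⊕₁≡h∘∇) ⟩
        hat a ∘ Σ⋆₁ ([ h , id ] ∘ (id ⊕₁ h)) ≡⟨ cong (hat a ∘_) (sym Σ⋆₁-homomorphism) ⟩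
        hat a ∘ Σ⋆₁ [ h , id ] ∘ Σ⋆₁ (id ⊕₁ h) ≡⟨ sym assoc ⟩
        K ∘ Σ⋆₁ (id ⊕₁ h)                ∎
        where
        [h,id]∘⊕₁≡h∘∇ : [ h , id ] ∘ (id ⊕₁ h) ≡ h ∘ ∇
        [h,id]∘⊕₁≡h∘∇ = trans []∘⊕₁ (trans (cong₂ [_,_] identityʳ identityˡ)
                                  (sym (trans ∘[] (cong₂ [_,_] identityʳ identityʳ))))

      club-fold-solves : ∀ {a♣} → IsClub init law a a♣ → IsPrimRec E (B₁ h id ∘ a♣)
      club-fold-solves {a♣} ca = begin
        (B₁ h id ∘ a♣) ∘ ι
          ≡⟨ trans assoc (cong (B₁ h id ∘_) ca) ⟩
        B₁ h id ∘ B₁ id (hat a) ∘ B₁ id (Σ⋆₁ ∇) ∘ ρ (pointed a) A ∘ Σ₁ ⟨ h , a♣ ⟩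
          ≡⟨ cong (B₁ h id ∘_) (pullˡ B₁-id-∘) ⟩
        B₁ h id ∘ B₁ id (hat a ∘ Σ⋆₁ ∇) ∘ ρ (pointed a) A ∘ Σ₁ ⟨ h , a♣ ⟩
          ≡⟨ trans (pullˡ B₁-commute) assoc ⟩
        B₁ id (hat a ∘ Σ⋆₁ ∇) ∘ B₁ h id ∘ ρ (pointed a) A ∘ Σ₁ ⟨ h , a♣ ⟩
          ≡⟨ cong (λ z → B₁ id (hat a ∘ Σ⋆₁ ∇) ∘ B₁ h id ∘ ρ (pointed a) A ∘ z)
                  (sym (trans Σ₁-⊗₁∘⟨⟩ (cong₂ (λ u v → Σ₁ ⟨ u , v ⟩) identityʳ identityˡ))) ⟩
        B₁ id (hat a ∘ Σ⋆₁ ∇) ∘ B₁ h id ∘ ρ (pointed a) A ∘ Σ₁ (h ⊗₁ id) ∘ Σ₁ ⟨ id , a♣ ⟩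
          ≡⟨ cong (B₁ id (hat a ∘ Σ⋆₁ ∇) ∘_) (precompose₃ (sym (dinatural fold-pointed A))) ⟩
        B₁ id (hat a ∘ Σ⋆₁ ∇) ∘ B₁ id (Σ⋆₁ (h ⊕₁ id)) ∘ ρ (pointed ι) A
          ∘ Σ₁ (id ⊗₁ B₁ h id) ∘ Σ₁ ⟨ id , a♣ ⟩
          ≡⟨ pullˡ B₁-id-∘ ⟩
        B₁ id ((hat a ∘ Σ⋆₁ ∇) ∘ Σ⋆₁ (h ⊕₁ id)) ∘ ρ (pointed ι) A
          ∘ Σ₁ (id ⊗₁ B₁ h id) ∘ Σ₁ ⟨ id , a♣ ⟩
          ≡⟨ cong₂ (λ z w → B₁ id z ∘ ρ (pointed ι) A ∘ w) hat∘Σ⋆∇∘Σ⋆⊕₁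
                   (trans Σ₁-⊗₁∘⟨⟩ (cong (λ u → Σ₁ ⟨ u , B₁ h id ∘ a♣ ⟩) identityˡ)) ⟩
        B₁ id K ∘ ρ (pointed ι) A ∘ Σ₁ ⟨ id , B₁ h id ∘ a♣ ⟩
          ≡⟨ sym assoc ⟩
        E ∘ Σ₁ ⟨ id , B₁ h id ∘ a♣ ⟩ ∎

      club-initial-solves : ∀ {ι♣} → IsClub init law ι ι♣ → IsPrimRec E (B₁ id h ∘ ι♣)
      club-initial-solves {ι♣} cι = begin
        (B₁ id h ∘ ι♣) ∘ ι
          ≡⟨ trans assoc (cong (B₁ id h ∘_) cι) ⟩
        B₁ id h ∘ B₁ id (hat ι) ∘ B₁ id (Σ⋆₁ ∇) ∘ ρ (pointed ι) μΣ ∘ Σ₁ ⟨ fold ι , ι♣ ⟩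
          ≡⟨ cong (λ z → B₁ id h ∘ B₁ id (hat ι) ∘ B₁ id (Σ⋆₁ ∇) ∘ ρ (pointed ι) μΣ
                         ∘ Σ₁ ⟨ z , ι♣ ⟩) fold-ι≡id ⟩
        B₁ id h ∘ B₁ id (hat ι) ∘ B₁ id (Σ⋆₁ ∇) ∘ ρ (pointed ι) μΣ ∘ Σ₁ ⟨ id , ι♣ ⟩
          ≡⟨ trans (cong (B₁ id h ∘_) (pullˡ B₁-id-∘)) (pullˡ B₁-id-∘) ⟩
        B₁ id (h ∘ hat ι ∘ Σ⋆₁ ∇) ∘ ρ (pointed ι) μΣ ∘ Σ₁ ⟨ id , ι♣ ⟩
          ≡⟨ cong (λ z → B₁ id z ∘ ρ (pointed ι) μΣ ∘ Σ₁ ⟨ id , ι♣ ⟩) fold∘hat∘Σ⋆∇ ⟩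
        B₁ id (K ∘ Σ⋆₁ (id ⊕₁ h)) ∘ ρ (pointed ι) μΣ ∘ Σ₁ ⟨ id , ι♣ ⟩
          ≡⟨ sym (pullˡ B₁-id-∘) ⟩
        B₁ id K ∘ B₁ id (Σ⋆₁ (id ⊕₁ h)) ∘ ρ (pointed ι) μΣ ∘ Σ₁ ⟨ id , ι♣ ⟩
          ≡⟨ cong (B₁ id K ∘_) (pullˡ (natural (pointed ι) h)) ⟩
        B₁ id K ∘ (ρ (pointed ι) A ∘ Σ₁ (id ⊗₁ B₁ id h)) ∘ Σ₁ ⟨ id , ι♣ ⟩
          ≡⟨ cong (B₁ id K ∘_) (trans assoc (cong (ρ (pointed ι) A ∘_)
               (trans Σ₁-⊗₁∘⟨⟩ (cong (λ u → Σ₁ ⟨ u , B₁ id h ∘ ι♣ ⟩) identityˡ)))) ⟩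
        B₁ id K ∘ ρ (pointed ι) A ∘ Σ₁ ⟨ id , B₁ id h ∘ ι♣ ⟩
          ≡⟨ sym assoc ⟩
        E ∘ Σ₁ ⟨ id , B₁ id h ∘ ι♣ ⟩ ∎

lemma4p13 : ∀ {o ℓ} (C : Category o ℓ) (lim : FinitelyComplete C) (colim : FinitelyCocomplete C)
    (V : Category.Obj C) (Σ' : Endofunctor C) (free : HasFreeAlgebras C Σ') (B : Bifunctor C) →
    let open Category C
        open Setting C lim colim V Σ' free B
        open Bifunctor B
    in (init : InitialΣAlgebra) (law : PointedHOGSOS) →
    let open InitialΣAlgebra init
    in (A : Obj) (a : Hom (Σ₀ A) A)
       (a♣ : Hom μΣ (B₀ A A)) (ι♣ : Hom μΣ (B₀ μΣ μΣ)) →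
       IsClub init law a a♣ → IsClub init law ι ι♣ →
       B₁ (fold a) id ∘ a♣ ≡ B₁ id (fold a) ∘ ι♣
lemma4p13 C lim colim V Σ' free B init law A a a♣ ι♣ ca cι =
  primRec-unique init (club-fold-solves init law a ca) (club-initial-solves init law a cι)
  where open ClubNaturality C lim colim V Σ' free B
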